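{- Let $n$ be a positive integer. For every integer $j$ with $1\leq j\leq \lfloor (n-1)/2\rfloor$, \[ \binom{n}{2j+1}=\sum_{i=j}^{\lfloor (n-1)/2\rfloor}(-1)^{i-j}2^{n-1-2i}\binom{i}{j}\binom{n-1-i}{i}, \qquad \binom{n-1-j}{j}=2^{ -n+1+2j}\sum_{i=j}^{\lfloor (n-1)/2\rfloor}\binom{n}{2i+1}\binom{i}{j}. \] -}

module Defs where

open import Data.Nat using (ℕ; zero; suc; _+_; _∸_)
open import Data.List using (List; []; _∷_; map; foldr)
open import Data.Nat.ListAction using (sum)
open import Data.Integer as ℤ using (ℤ)

-- range a b = [a, a+1, ..., b]  (empty if b < a)
range : ℕ → ℕ → List ℕ
range a b = go a (suc b ∸ a)
  where
  go : ℕ → ℕ → List ℕ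
  go x zero = []
  go x (suc k) = x ∷ go (suc x) k

Σℕ[_to_] : ℕ → ℕ → (ℕ → ℕ) → ℕ
Σℕ[ a to b ] f = sum (map f (range a b))

Σℤ[_to_] : ℕ → ℕ → (ℕ → ℤ) → ℤ
Σℤ[ a to b ] f = foldr ℤ._+_ (ℤ.+ 0) (map f (range a b))

sign : ℕ → ℤ
sign zero = ℤ.+ 1
sign (suc k) = ℤ.- sign k

module Submission where

-- Write  m = n - 1,  odd m k = C(m+1, 2k+1)  and  cheb m j = 2^(m-2j) C(m-j, j)
-- (the coefficients of the Chebyshev polynomial U_m).  The corollary consists of
-- the two binomial-transform identities
--
--   (II)  cheb m j = Σ_k C(k,j) odd m k,          (I)  odd m j = Σ_i (-1)^(i-j) C(i,j) cheb m i.
--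
-- (II) is proved by induction on m: both sides satisfy the same three-term
-- recurrence  u (m+2) j = 2 u (m+1) j + u m (j-1)  (for odd m this is the
-- second difference of Pascal's rule, for cheb m a short computation with
-- truncated subtraction).  (I) is not proved separately: it is the binomial
-- inversion of (II), and inversion follows from the orthogonality relation
-- Σ_i (-1)^(i-j) C(k,i) C(i,j) = [k = j].

open import Defs
open import Data.Nat using (ℕ; zero; suc; _+_; _*_; _∸_; _^_; _≤_; _<_; _/_; z≤n; s≤s; _≤?_)
open import Data.Nat.Properties
open import Data.Nat.DivMod using (m*n/n≡m; /-monoˡ-≤; m/n≤m)
open import Data.Nat.Combinatorics using (_C_; nCk+nC[k+1]≡[n+1]C[k+1]; k>n⇒nCk≡0)
open import Data.Integer as ℤ using (ℤ; +_; -_)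
import Data.Integer.Properties as ℤP
open import Algebra.Properties.AbelianGroup ℤP.+-0-abelianGroup using (∙-cancelʳ)
import Data.Nat.Tactic.RingSolver as ℕ-Solver
import Data.Integer.Tactic.RingSolver as ℤ-Solver
open import Data.Fin using (toℕ)
open import Data.Fin.Properties using (toℕ<n)
open import Algebra.Properties.Semiring.Sum ℤP.+-*-semiring
  using (sum; sum-cong-≗; sum-replicate-zero; ∑-comm; ∑-distrib-+; *-distribˡ-sum; *-distribʳ-sum)
open import Data.List using ([]; _∷_; map; foldr)
open import Data.List.Properties using (map-cong)
open import Data.Product using (_×_; _,_)
open import Data.Empty using (⊥-elim)
open import Relation.Nullary using (yes; no)
open import Relation.Binary.PropositionalEquality

-- Binomial coefficients computed by Pascal's rule, so that they unfold by
-- pattern matching; they agree with the library's  n C k.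
choose : ℕ → ℕ → ℕ
choose n       zero    = 1
choose zero    (suc k) = 0
choose (suc n) (suc k) = choose n k + choose n (suc k)

choose≡C : ∀ n k → choose n k ≡ n C k
choose≡C n       zero    = refl
choose≡C zero    (suc k) = sym (k>n⇒nCk≡0 {0} {suc k} (s≤s z≤n))
choose≡C (suc n) (suc k) =
  trans (cong₂ _+_ (choose≡C n k) (choose≡C n (suc k))) (nCk+nC[k+1]≡[n+1]C[k+1] n k)

choose-vanish : ∀ {n k} → n < k → choose n k ≡ 0
choose-vanish {zero}  {suc k} _         = refl
choose-vanish {suc n} {suc k} (s≤s n<k) =
  cong₂ _+_ (choose-vanish n<k) (choose-vanish (m<n⇒m<1+n n<k))

-- shift z f is the sequence f moved one step up, with z in position 0:
-- (shift z f) j = f (j - 1).  It describes how all our families react to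
-- increasing the upper index.
shift : {A : Set} → A → (ℕ → A) → ℕ → A
shift z f zero    = z
shift z f (suc j) = f j

shift-cong : ∀ {A : Set} {z : A} {f g : ℕ → A} → (∀ i → f i ≡ g i) → ∀ j → shift z f j ≡ shift z g j
shift-cong eq zero    = refl
shift-cong eq (suc j) = eq j

choose-second-difference : ∀ n r →
  choose (2 + n) r + choose n r ≡ 2 * choose (1 + n) r + shift 0 (shift 0 (choose n)) r
choose-second-difference n zero          = refl
choose-second-difference n (suc zero)    = alg (choose n 1)
  where alg : ∀ c → 1 + (1 + c) + c ≡ 2 * (1 + c) + 0
        alg = ℕ-Solver.solve-∀
choose-second-difference n (suc (suc r)) = alg (choose n r) (choose n (suc r)) (choose n (suc (suc r)))
  where alg : ∀ a b c → a + b + (b + c) + c ≡ 2 * (b + c) + a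
        alg = ℕ-Solver.solve-∀

two-suc : ∀ k → 2 * suc k ≡ suc (suc (2 * k))
two-suc k = *-suc 2 k

odd : ℕ → ℕ → ℕ
odd m k = choose (suc m) (2 * k + 1)

odd-rec : ∀ m k → odd (2 + m) k + odd m k ≡ 2 * odd (1 + m) k + shift 0 (odd m) k
odd-rec m k = trans (choose-second-difference (suc m) (2 * k + 1)) (cong (λ e → 2 * odd (1 + m) k + e) (two-below k))
  where
  two-below : ∀ k → shift 0 (shift 0 (choose (suc m))) (2 * k + 1) ≡ shift 0 (odd m) k
  two-below zero    = refl
  two-below (suc k) = cong (λ e → shift 0 (shift 0 (choose (suc m))) (e + 1)) (two-suc k)

odd-vanish : ∀ {m k} → m < 2 * k → odd m k ≡ 0
odd-vanish {m} {k} lt = choose-vanish (subst (suc m <_) (+-comm 1 (2 * k)) (s≤s lt))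

cheb : ℕ → ℕ → ℕ
cheb m j = 2 ^ (m ∸ 2 * j) * choose (m ∸ j) j

-- Unfolding  cheb (m+1) (j+1)  without truncated subtraction in the way.
cheb-suc : ∀ m j → cheb (suc m) (suc j) ≡ 2 ^ (m ∸ suc (2 * j)) * choose (m ∸ j) (suc j)
cheb-suc m j = cong (λ e → 2 ^ (suc m ∸ e) * choose (m ∸ j) (suc j)) (two-suc j)

choose-diagonal : ∀ m j → choose (suc m ∸ j) (suc j) ≡ choose (m ∸ j) j + choose (m ∸ j) (suc j)
choose-diagonal m j with j ≤? m
... | yes j≤m rewrite +-∸-assoc 1 j≤m = refl
... | no j≰m rewrite m≤n⇒m∸n≡0 (≰⇒> j≰m) | m≤n⇒m∸n≡0 (<⇒≤ (≰⇒> j≰m)) =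
  sym (trans (+-identityʳ (choose 0 j)) (choose-vanish (≤-<-trans z≤n (≰⇒> j≰m))))

-- Lowering the power of 2 by one is compensated by a factor 2, except when
-- the binomial factor vanishes anyway.
doubling : ∀ m j →
  2 ^ (m ∸ 2 * j) * choose (m ∸ j) (suc j) ≡ 2 * (2 ^ (m ∸ suc (2 * j)) * choose (m ∸ j) (suc j))
doubling m j with suc (2 * j) ≤? m
... | yes 2j<m = trans (cong (λ e → 2 ^ e * choose (m ∸ j) (suc j)) (+-∸-assoc 1 2j<m))
                      (*-assoc 2 (2 ^ (m ∸ suc (2 * j))) (choose (m ∸ j) (suc j)))
... | no 2j≮m = subst (λ c → P * c ≡ 2 * (Q * c)) (sym (choose-vanish (m<n+o⇒m∸n<o m j small)))
                      (trans (*-zeroʳ P) (sym (cong (2 *_) (*-zeroʳ Q))))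
  where P = 2 ^ (m ∸ 2 * j)
        Q = 2 ^ (m ∸ suc (2 * j))
        small : m < j + suc j
        small = subst (m <_) (sym (trans (+-suc j j) (cong (λ e → suc (j + e)) (sym (+-identityʳ j)))))
                      (s≤s (≮⇒≥ 2j≮m))

cheb-rec : ∀ m j → cheb (2 + m) j ≡ 2 * cheb (1 + m) j + shift 0 (cheb m) j
cheb-rec m zero    = alg (2 ^ m)
  where alg : ∀ p → 2 * (2 * p) * 1 ≡ 2 * (2 * p * 1) + 0
        alg = ℕ-Solver.solve-∀
cheb-rec m (suc j) = begin
    cheb (2 + m) (suc j)
  ≡⟨ cheb-suc (suc m) j ⟩
    P * choose (suc m ∸ j) (suc j)
  ≡⟨ cong (P *_) (choose-diagonal m j) ⟩
    P * (a + b)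
  ≡⟨ *-distribˡ-+ P a b ⟩
    P * a + P * b
  ≡⟨ cong (λ e → P * a + e) (doubling m j) ⟩
    P * a + 2 * (Q * b)
  ≡⟨ +-comm (P * a) _ ⟩
    2 * (Q * b) + P * a
  ≡⟨ cong (λ e → 2 * e + P * a) (sym (cheb-suc m j)) ⟩
    2 * cheb (1 + m) (suc j) + cheb m j ∎
  where
  open ≡-Reasoning
  P = 2 ^ (m ∸ 2 * j)
  Q = 2 ^ (m ∸ suc (2 * j))
  a = choose (m ∸ j) j
  b = choose (m ∸ j) (suc j)

-- cheb m j = 0 once 2j > m, because then m - j < j.
cheb-vanish : ∀ {m j} → m < 2 * j → cheb m j ≡ 0
cheb-vanish {m} {suc j} lt =
  trans (cong (2 ^ (m ∸ 2 * suc j) *_) (choose-vanish (m<n+o⇒m∸n<o m (suc j) lt′))) (*-zeroʳ (2 ^ (m ∸ 2 * suc j)))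
  where lt′ : m < suc j + suc j
        lt′ = subst (m <_) (cong (λ e → suc j + e) (+-identityʳ (suc j))) lt

Σ< : ℕ → (ℕ → ℤ) → ℤ
Σ< B f = sum {B} (λ i → f (toℕ i))

Σ<-cong : ∀ B {f g : ℕ → ℤ} → (∀ i → i < B → f i ≡ g i) → Σ< B f ≡ Σ< B g
Σ<-cong B eq = sum-cong-≗ (λ i → eq (toℕ i) (toℕ<n i))

Σ<-zero : ∀ B {f : ℕ → ℤ} → (∀ i → i < B → f i ≡ + 0) → Σ< B f ≡ + 0
Σ<-zero B eq = trans (Σ<-cong B eq) (sum-replicate-zero B)

Σ<-split : ∀ a k (f : ℕ → ℤ) → Σ< (a + k) f ≡ Σ< a f ℤ.+ Σ< k (λ t → f (a + t))
Σ<-split zero    k f = sym (ℤP.+-identityˡ _)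
Σ<-split (suc a) k f =
  trans (cong (λ e → f 0 ℤ.+ e) (Σ<-split a k (λ i → f (suc i)))) (sym (ℤP.+-assoc (f 0) _ _))

Σ<-split-at : ∀ {a b} (f : ℕ → ℤ) → a ≤ b → Σ< b f ≡ Σ< a f ℤ.+ Σ< (b ∸ a) (λ t → f (a + t))
Σ<-split-at {a} {b} f a≤b = trans (cong (λ n → Σ< n f) (sym (m+[n∸m]≡n a≤b))) (Σ<-split a (b ∸ a) f)

Σ<-+ : ∀ B (f g : ℕ → ℤ) → Σ< B (λ i → f i ℤ.+ g i) ≡ Σ< B f ℤ.+ Σ< B g
Σ<-+ B f g = ∑-distrib-+ {B} (λ i → f (toℕ i)) (λ i → g (toℕ i))

Σ<-comm : ∀ A B (f : ℕ → ℕ → ℤ) →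
  Σ< A (λ i → Σ< B (λ k → f i k)) ≡ Σ< B (λ k → Σ< A (λ i → f i k))
Σ<-comm A B f = ∑-comm {A} {B} (λ i k → f (toℕ i) (toℕ k))

Σ<-*ˡ : ∀ B c (f : ℕ → ℤ) → c ℤ.* Σ< B f ≡ Σ< B (λ i → c ℤ.* f i)
Σ<-*ˡ B c f = *-distribˡ-sum {B} c (λ i → f (toℕ i))

Σ<-*ʳ : ∀ B c (f : ℕ → ℤ) → Σ< B f ℤ.* c ≡ Σ< B (λ i → f i ℤ.* c)
Σ<-*ʳ B c f = *-distribʳ-sum {B} c (λ i → f (toℕ i))

Σ<-shift : ∀ B (g : ℕ → ℕ → ℤ) (y : ℕ → ℤ) j →
  Σ< B (λ i → shift (+ 0) (g i) j ℤ.* y i) ≡ shift (+ 0) (λ j → Σ< B (λ i → g i j ℤ.* y i)) j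
Σ<-shift B g y zero    = sum-replicate-zero B
Σ<-shift B g y (suc j) = refl

choose-suc : ∀ n r → + choose (suc n) r ≡ + choose n r ℤ.+ shift (+ 0) (λ r → + choose n r) r
choose-suc n zero    = refl
choose-suc n (suc r) = trans (cong +_ (+-comm (choose n r) _)) (ℤP.pos-+ (choose n (suc r)) _)

transform : ℕ → (ℕ → ℤ) → ℕ → ℤ
transform B x j = Σ< B (λ k → + choose k j ℤ.* x k)

transform-cong : ∀ B {x y : ℕ → ℤ} → (∀ k → x k ≡ y k) → ∀ j → transform B x j ≡ transform B y j
transform-cong B eq j = Σ<-cong B (λ k _ → cong (+ choose k j ℤ.*_) (eq k))

transform-+ : ∀ B (x y : ℕ → ℤ) j → transform B (λ k → x k ℤ.+ y k) j ≡ transform B x j ℤ.+ transform B y j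
transform-+ B x y j =
  trans (Σ<-cong B (λ k _ → ℤP.*-distribˡ-+ (+ choose k j) (x k) (y k)))
        (Σ<-+ B (λ k → + choose k j ℤ.* x k) (λ k → + choose k j ℤ.* y k))

transform-scale : ∀ B c (x : ℕ → ℤ) j → transform B (λ k → c ℤ.* x k) j ≡ c ℤ.* transform B x j
transform-scale B c x j =
  trans (Σ<-cong B (λ k _ → swap (+ choose k j) c (x k))) (sym (Σ<-*ˡ B c (λ k → + choose k j ℤ.* x k)))
  where swap : ∀ a c x → a ℤ.* (c ℤ.* x) ≡ c ℤ.* (a ℤ.* x)
        swap = ℤ-Solver.solve-∀

-- Transforming a shifted sequence: by Pascal's rule C(k+1,j) = C(k,j) + C(k,j-1).
transform-shift : ∀ B (x : ℕ → ℤ) j →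
  transform (suc B) (shift (+ 0) x) j ≡ transform B x j ℤ.+ shift (+ 0) (transform B x) j
transform-shift B x j = begin
    + choose 0 j ℤ.* + 0 ℤ.+ Σ< B (λ k → + choose (suc k) j ℤ.* x k)
  ≡⟨ cong (ℤ._+ Σ< B (λ k → + choose (suc k) j ℤ.* x k)) (ℤP.*-zeroʳ (+ choose 0 j)) ⟩
    + 0 ℤ.+ Σ< B (λ k → + choose (suc k) j ℤ.* x k)
  ≡⟨ ℤP.+-identityˡ _ ⟩
    Σ< B (λ k → + choose (suc k) j ℤ.* x k)
  ≡⟨ Σ<-cong B (λ k _ → trans (cong (ℤ._* x k) (choose-suc k j))
                              (ℤP.*-distribʳ-+ (x k) (+ choose k j) (shift (+ 0) (λ r → + choose k r) j))) ⟩
    Σ< B (λ k → + choose k j ℤ.* x k ℤ.+ shift (+ 0) (λ r → + choose k r) j ℤ.* x k)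
  ≡⟨ Σ<-+ B (λ k → + choose k j ℤ.* x k) (λ k → shift (+ 0) (λ r → + choose k r) j ℤ.* x k) ⟩
    transform B x j ℤ.+ Σ< B (λ k → shift (+ 0) (λ r → + choose k r) j ℤ.* x k)
  ≡⟨ cong (λ e → transform B x j ℤ.+ e) (Σ<-shift B (λ k r → + choose k r) x j) ⟩
    transform B x j ℤ.+ shift (+ 0) (transform B x) j ∎
  where open ≡-Reasoning

alt : ℕ → ℕ → ℤ
alt i j = sign (i ∸ j) ℤ.* + choose i j

-- The two terms of  alt (i+1) (j+1)  involving C(i, j+1) cancel against  alt i (j+1).
alt-cancel : ∀ i j → sign (i ∸ j) ℤ.* + choose i (suc j) ℤ.+ alt i (suc j) ≡ + 0
alt-cancel i j with i ≤? j
... | yes i≤j rewrite choose-vanish (s≤s i≤j) | ℤP.*-zeroʳ (sign (i ∸ j)) | ℤP.*-zeroʳ (sign (i ∸ suc j)) = refl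
... | no i≰j rewrite +-∸-assoc 1 (≰⇒> i≰j) = alg (sign (i ∸ suc j)) (+ choose i (suc j))
  where alg : ∀ s c → (- s) ℤ.* c ℤ.+ s ℤ.* c ≡ + 0
        alg = ℤ-Solver.solve-∀

alt-suc : ∀ i j → alt (suc i) j ℤ.+ alt i j ≡ shift (+ 0) (alt i) j
alt-suc i zero    = alg (sign i)
  where alg : ∀ s → (- s) ℤ.* + 1 ℤ.+ s ℤ.* + 1 ≡ + 0
        alg = ℤ-Solver.solve-∀
alt-suc i (suc j) = begin
    s ℤ.* + (choose i j + choose i (suc j)) ℤ.+ alt i (suc j)
  ≡⟨ cong (λ e → s ℤ.* e ℤ.+ alt i (suc j)) (ℤP.pos-+ (choose i j) _) ⟩
    s ℤ.* (+ choose i j ℤ.+ + choose i (suc j)) ℤ.+ alt i (suc j)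
  ≡⟨ alg s (+ choose i j) (+ choose i (suc j)) (alt i (suc j)) ⟩
    alt i j ℤ.+ (s ℤ.* + choose i (suc j) ℤ.+ alt i (suc j))
  ≡⟨ cong (λ e → alt i j ℤ.+ e) (alt-cancel i j) ⟩
    alt i j ℤ.+ + 0
  ≡⟨ ℤP.+-identityʳ _ ⟩
    alt i j ∎
  where
  open ≡-Reasoning
  s = sign (i ∸ j)
  alg : ∀ s a b z → s ℤ.* (a ℤ.+ b) ℤ.+ z ≡ s ℤ.* a ℤ.+ (s ℤ.* b ℤ.+ z)
  alg = ℤ-Solver.solve-∀

-- Kronecker's delta, defined so that  δ (k+1) = shift 0 (δ k).
δ : ℕ → ℕ → ℤ
δ zero    zero    = + 1
δ zero    (suc j) = + 0
δ (suc k) j       = shift (+ 0) (δ k) j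

δ-sum : ∀ B (x : ℕ → ℤ) j → j < B → Σ< B (λ k → δ k j ℤ.* x k) ≡ x j
δ-sum (suc B) x zero    _         =
  trans (cong₂ ℤ._+_ (ℤP.*-identityˡ (x 0)) (sum-replicate-zero B)) (ℤP.+-identityʳ (x 0))
δ-sum (suc B) x (suc j) (s≤s j<B) = trans (ℤP.+-identityˡ _) (δ-sum B (λ k → x (suc k)) j j<B)

-- Induction on k: Pascal's rule for C(k+1,i) gives the sum for k plus the sum R with
-- i shifted by one, and by alt-suc  R + δ k j  is the shifted sum for k, i.e. δ (k+1) j.
alt-orthogonal : ∀ k B → k < B → ∀ j → Σ< B (λ i → alt i j ℤ.* + choose k i) ≡ δ k j
alt-orthogonal zero (suc B) _ j =
  trans (cong (λ e → alt 0 j ℤ.* + 1 ℤ.+ e) (Σ<-zero B (λ i _ → ℤP.*-zeroʳ (alt (suc i) j))))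
        (trans (ℤP.+-identityʳ _) (leading j))
  where leading : ∀ j → alt 0 j ℤ.* + 1 ≡ δ 0 j
        leading zero    = refl
        leading (suc j) = refl
alt-orthogonal (suc k) (suc B) (s≤s k<B) j = begin
    Σ< (suc B) (λ i → alt i j ℤ.* + choose (suc k) i)
  ≡⟨ Σ<-cong (suc B) (λ i _ → trans (cong (alt i j ℤ.*_) (choose-suc k i))
                                    (ℤP.*-distribˡ-+ (alt i j) (+ choose k i) (shift (+ 0) (λ r → + choose k r) i))) ⟩
    Σ< (suc B) (λ i → alt i j ℤ.* + choose k i ℤ.+ alt i j ℤ.* shift (+ 0) (λ r → + choose k r) i)
  ≡⟨ Σ<-+ (suc B) (λ i → alt i j ℤ.* + choose k i) (λ i → alt i j ℤ.* shift (+ 0) (λ r → + choose k r) i) ⟩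
    Σ< (suc B) (λ i → alt i j ℤ.* + choose k i) ℤ.+ (alt 0 j ℤ.* + 0 ℤ.+ R)
  ≡⟨ cong₂ ℤ._+_ (alt-orthogonal k (suc B) (m<n⇒m<1+n k<B) j)
                 (trans (cong (ℤ._+ R) (ℤP.*-zeroʳ (alt 0 j))) (ℤP.+-identityˡ R)) ⟩
    δ k j ℤ.+ R
  ≡⟨ ℤP.+-comm (δ k j) R ⟩
    R ℤ.+ δ k j
  ≡⟨ cong (λ e → R ℤ.+ e) (sym (alt-orthogonal k B k<B j)) ⟩
    R ℤ.+ Σ< B (λ i → alt i j ℤ.* + choose k i)
  ≡⟨ sym (Σ<-+ B (λ i → alt (suc i) j ℤ.* + choose k i) (λ i → alt i j ℤ.* + choose k i)) ⟩
    Σ< B (λ i → alt (suc i) j ℤ.* + choose k i ℤ.+ alt i j ℤ.* + choose k i)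
  ≡⟨ Σ<-cong B (λ i _ → trans (sym (ℤP.*-distribʳ-+ (+ choose k i) (alt (suc i) j) (alt i j)))
                              (cong (ℤ._* + choose k i) (alt-suc i j))) ⟩
    Σ< B (λ i → shift (+ 0) (alt i) j ℤ.* + choose k i)
  ≡⟨ Σ<-shift B alt (λ i → + choose k i) j ⟩
    shift (+ 0) (λ j → Σ< B (λ i → alt i j ℤ.* + choose k i)) j
  ≡⟨ shift-cong (alt-orthogonal k B k<B) j ⟩
    δ (suc k) j ∎
  where
  open ≡-Reasoning
  R = Σ< B (λ i → alt (suc i) j ℤ.* + choose k i)

binomial-inversion : ∀ B (x : ℕ → ℤ) j → j < B → Σ< B (λ i → alt i j ℤ.* transform B x i) ≡ x j
binomial-inversion B x j j<B = begin
    Σ< B (λ i → alt i j ℤ.* Σ< B (λ k → + choose k i ℤ.* x k))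
  ≡⟨ Σ<-cong B (λ i _ → Σ<-*ˡ B (alt i j) (λ k → + choose k i ℤ.* x k)) ⟩
    Σ< B (λ i → Σ< B (λ k → alt i j ℤ.* (+ choose k i ℤ.* x k)))
  ≡⟨ Σ<-comm B B (λ i k → alt i j ℤ.* (+ choose k i ℤ.* x k)) ⟩
    Σ< B (λ k → Σ< B (λ i → alt i j ℤ.* (+ choose k i ℤ.* x k)))
  ≡⟨ Σ<-cong B (λ k _ → trans (Σ<-cong B (λ i _ → sym (ℤP.*-assoc (alt i j) (+ choose k i) (x k))))
                              (sym (Σ<-*ʳ B (x k) (λ i → alt i j ℤ.* + choose k i)))) ⟩
    Σ< B (λ k → Σ< B (λ i → alt i j ℤ.* + choose k i) ℤ.* x k)
  ≡⟨ Σ<-cong B (λ k k<B → cong (ℤ._* x k) (alt-orthogonal k B k<B j)) ⟩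
    Σ< B (λ k → δ k j ℤ.* x k)
  ≡⟨ δ-sum B x j j<B ⟩
    x j ∎
  where open ≡-Reasoning

+-2*+ : ∀ c s → + (2 * c + s) ≡ + 2 ℤ.* + c ℤ.+ + s
+-2*+ c s = trans (ℤP.pos-+ (2 * c) s) (cong (λ e → e ℤ.+ + s) (ℤP.pos-* 2 c))

shift-cast : ∀ (f : ℕ → ℕ) j → + shift 0 f j ≡ shift (+ 0) (λ i → + f i) j
shift-cast f zero    = refl
shift-cast f (suc j) = refl

transform-head : ∀ B (x : ℕ → ℤ) j → (∀ k → x (suc k) ≡ + 0) → transform (suc B) x j ≡ + choose 0 j ℤ.* x 0
transform-head B x j vanish =
  trans (cong (λ e → + choose 0 j ℤ.* x 0 ℤ.+ e)
              (Σ<-zero B (λ k _ → trans (cong (+ choose (suc k) j ℤ.*_) (vanish k)) (ℤP.*-zeroʳ (+ choose (suc k) j)))))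
        (ℤP.+-identityʳ _)

odd-transform-rec : ∀ B m j →
  transform B (λ k → + odd (2 + m) k) j ℤ.+ transform B (λ k → + odd m k) j
    ≡ + 2 ℤ.* transform B (λ k → + odd (1 + m) k) j ℤ.+ transform B (shift (+ 0) (λ k → + odd m k)) j
odd-transform-rec B m j = begin
    transform B o₂ j ℤ.+ transform B o₀ j
  ≡⟨ sym (transform-+ B o₂ o₀ j) ⟩
    transform B (λ k → o₂ k ℤ.+ o₀ k) j
  ≡⟨ transform-cong B pointwise j ⟩
    transform B (λ k → + 2 ℤ.* o₁ k ℤ.+ shift (+ 0) o₀ k) j
  ≡⟨ transform-+ B (λ k → + 2 ℤ.* o₁ k) (shift (+ 0) o₀) j ⟩
    transform B (λ k → + 2 ℤ.* o₁ k) j ℤ.+ transform B (shift (+ 0) o₀) j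
  ≡⟨ cong (λ e → e ℤ.+ transform B (shift (+ 0) o₀) j) (transform-scale B (+ 2) o₁ j) ⟩
    + 2 ℤ.* transform B o₁ j ℤ.+ transform B (shift (+ 0) o₀) j ∎
  where
  open ≡-Reasoning
  o₀ o₁ o₂ : ℕ → ℤ
  o₀ k = + odd m k
  o₁ k = + odd (1 + m) k
  o₂ k = + odd (2 + m) k
  pointwise : ∀ k → o₂ k ℤ.+ o₀ k ≡ + 2 ℤ.* o₁ k ℤ.+ shift (+ 0) o₀ k
  pointwise k = begin
      o₂ k ℤ.+ o₀ k
    ≡⟨ sym (ℤP.pos-+ (odd (2 + m) k) (odd m k)) ⟩
      + (odd (2 + m) k + odd m k)
    ≡⟨ cong +_ (odd-rec m k) ⟩
      + (2 * odd (1 + m) k + shift 0 (odd m) k)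
    ≡⟨ +-2*+ (odd (1 + m) k) (shift 0 (odd m) k) ⟩
      + 2 ℤ.* o₁ k ℤ.+ + shift 0 (odd m) k
    ≡⟨ cong (λ e → + 2 ℤ.* o₁ k ℤ.+ e) (shift-cast (odd m) k) ⟩
      + 2 ℤ.* o₁ k ℤ.+ shift (+ 0) o₀ k ∎

-- Both base cases m = 0, 1 only see the term k = 0, since C(m+1, 2k+1) = 0 for k ≥ 1.
one<2*suc : ∀ k → 1 < 2 * suc k
one<2*suc k = subst (1 <_) (sym (two-suc k)) (s≤s (s≤s z≤n))

-- The inductive step feeds the hypotheses for m+1 and m (at bounds B+1 and B) into the
-- transformed recurrence, and cancels the term cheb m j against cheb-rec.
odd-transform : ∀ m B → m < B → ∀ j → transform B (λ k → + odd m k) j ≡ + cheb m j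
odd-transform zero (suc B) _ j =
  trans (transform-head B (λ k → + odd 0 k) j (λ k → cong +_ (odd-vanish {0} {suc k} (s≤s z≤n)))) (leading j)
  where leading : ∀ j → + choose 0 j ℤ.* + 1 ≡ + cheb 0 j
        leading zero    = refl
        leading (suc j) = refl
odd-transform (suc zero) (suc B) _ j =
  trans (transform-head B (λ k → + odd 1 k) j (λ k → cong +_ (odd-vanish {1} {suc k} (one<2*suc k)))) (leading j)
  where leading : ∀ j → + choose 0 j ℤ.* + 2 ≡ + cheb 1 j
        leading zero    = refl
        leading (suc j) = sym (cong +_ (cheb-vanish {1} {suc j} (one<2*suc j)))
odd-transform (suc (suc m)) (suc B) (s≤s m+1<B) j =
  ∙-cancelʳ (+ cheb m j) (transform (suc B) o₂ j) (+ cheb (2 + m) j) (begin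
      transform (suc B) o₂ j ℤ.+ + cheb m j
    ≡⟨ cong (λ e → transform (suc B) o₂ j ℤ.+ e) (sym (odd-transform m (suc B) (m<n⇒m<1+n m<B) j)) ⟩
      transform (suc B) o₂ j ℤ.+ transform (suc B) o₀ j
    ≡⟨ odd-transform-rec (suc B) m j ⟩
      + 2 ℤ.* transform (suc B) o₁ j ℤ.+ transform (suc B) (shift (+ 0) o₀) j
    ≡⟨ cong₂ (λ a b → + 2 ℤ.* a ℤ.+ b) (odd-transform (suc m) (suc B) (s≤s m<B) j) (transform-shift B o₀ j) ⟩
      + 2 ℤ.* + cheb (1 + m) j ℤ.+ (transform B o₀ j ℤ.+ shift (+ 0) (transform B o₀) j)
    ≡⟨ cong (λ b → + 2 ℤ.* + cheb (1 + m) j ℤ.+ b)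
            (cong₂ ℤ._+_ (odd-transform m B m<B j) (shift-cong (odd-transform m B m<B) j)) ⟩
      + 2 ℤ.* + cheb (1 + m) j ℤ.+ (+ cheb m j ℤ.+ shift (+ 0) (λ i → + cheb m i) j)
    ≡⟨ cong (λ e → + 2 ℤ.* + cheb (1 + m) j ℤ.+ (+ cheb m j ℤ.+ e)) (sym (shift-cast (cheb m) j)) ⟩
      + 2 ℤ.* + cheb (1 + m) j ℤ.+ (+ cheb m j ℤ.+ + shift 0 (cheb m) j)
    ≡⟨ alg (+ 2 ℤ.* + cheb (1 + m) j) (+ cheb m j) (+ shift 0 (cheb m) j) ⟩
      + 2 ℤ.* + cheb (1 + m) j ℤ.+ + shift 0 (cheb m) j ℤ.+ + cheb m j
    ≡⟨ cong (λ e → e ℤ.+ + cheb m j)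
            (sym (trans (cong +_ (cheb-rec m j)) (+-2*+ (cheb (1 + m) j) (shift 0 (cheb m) j)))) ⟩
      + cheb (2 + m) j ℤ.+ + cheb m j ∎)
  where
  open ≡-Reasoning
  m<B : m < B
  m<B = ≤-trans (n≤1+n (suc m)) m+1<B
  o₀ o₁ o₂ : ℕ → ℤ
  o₀ k = + odd m k
  o₁ k = + odd (1 + m) k
  o₂ k = + odd (2 + m) k
  alg : ∀ a b c → a ℤ.+ (b ℤ.+ c) ≡ a ℤ.+ c ℤ.+ b
  alg = ℤ-Solver.solve-∀

range-cons : ∀ {a b} → a ≤ b → range a b ≡ a ∷ range (suc a) b
range-cons a≤b rewrite +-∸-assoc 1 a≤b = refl

Σℤ-range : ∀ (f : ℕ → ℤ) k a b → suc b ∸ a ≡ k → Σℤ[ a to b ] f ≡ Σ< k (λ t → f (a + t))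
Σℤ-range f zero    a b len rewrite len = refl
Σℤ-range f (suc k) a b len with a ≤? b
... | no a≰b = ⊥-elim (0≢1+n (trans (sym (m≤n⇒m∸n≡0 (≰⇒> a≰b))) len))
... | yes a≤b rewrite range-cons a≤b =
  cong₂ ℤ._+_ (cong f (sym (+-identityʳ a)))
    (trans (Σℤ-range f k (suc a) b (suc-injective (trans (sym (+-∸-assoc 1 a≤b)) len)))
           (Σ<-cong k (λ i _ → cong f (sym (+-suc a i)))))

Σℤ-as-Σ< : ∀ {j N B} (f : ℕ → ℤ) → j ≤ N → N < B →
  (∀ i → i < j → f i ≡ + 0) → (∀ i → N < i → f i ≡ + 0) → Σℤ[ j to N ] f ≡ Σ< B f
Σℤ-as-Σ< {j} {N} {B} f j≤N N<B below above = begin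
    Σℤ[ j to N ] f
  ≡⟨ Σℤ-range f (suc N ∸ j) j N refl ⟩
    Σ< (suc N ∸ j) (λ t → f (j + t))
  ≡⟨ sym (ℤP.+-identityˡ _) ⟩
    + 0 ℤ.+ Σ< (suc N ∸ j) (λ t → f (j + t))
  ≡⟨ cong (λ e → e ℤ.+ Σ< (suc N ∸ j) (λ t → f (j + t))) (sym (Σ<-zero j below)) ⟩
    Σ< j f ℤ.+ Σ< (suc N ∸ j) (λ t → f (j + t))
  ≡⟨ sym (Σ<-split-at f (m≤n⇒m≤1+n j≤N)) ⟩
    Σ< (suc N) f
  ≡⟨ sym (ℤP.+-identityʳ _) ⟩
    Σ< (suc N) f ℤ.+ + 0
  ≡⟨ cong (λ e → Σ< (suc N) f ℤ.+ e)
          (sym (Σ<-zero (B ∸ suc N) (λ i _ → above (suc N + i) (s≤s (m≤m+n N i))))) ⟩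
    Σ< (suc N) f ℤ.+ Σ< (B ∸ suc N) (λ t → f (suc N + t))
  ≡⟨ sym (Σ<-split-at f N<B) ⟩
    Σ< B f ∎
  where open ≡-Reasoning

Σℤ-cong : ∀ a b {f g : ℕ → ℤ} → (∀ i → f i ≡ g i) → Σℤ[ a to b ] f ≡ Σℤ[ a to b ] g
Σℤ-cong a b eq = cong (foldr ℤ._+_ (+ 0)) (map-cong eq (range a b))

Σℕ-cast : ∀ a b (f : ℕ → ℕ) → + Σℕ[ a to b ] f ≡ Σℤ[ a to b ] (λ i → + f i)
Σℕ-cast a b f = cast (range a b)
  where cast : ∀ xs → + foldr _+_ 0 (map f xs) ≡ foldr ℤ._+_ (+ 0) (map (λ i → + f i) xs)
        cast []       = refl
        cast (x ∷ xs) = trans (ℤP.pos-+ (f x) _) (cong (λ e → + f x ℤ.+ e) (cast xs))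

-- Indices beyond ⌊m/2⌋ satisfy 2i > m, where odd m i and cheb m i vanish.
half-bound : ∀ m i → m / 2 < i → m < 2 * i
half-bound m i lt = ≰⇒> (λ 2i≤m → <⇒≱ lt (i≤m/2 2i≤m))
  where i≤m/2 : 2 * i ≤ m → i ≤ m / 2
        i≤m/2 le = subst (_≤ m / 2) (m*n/n≡m i 2) (/-monoˡ-≤ 2 (subst (_≤ m) (*-comm 2 i) le))

-- Identity (I): binomial inversion of (II), restricted to the range j ≤ i ≤ ⌊m/2⌋
-- (it holds for j = 0 as well).
odd-identity : ∀ m j → j ≤ m / 2 →
  + (suc m C (2 * j + 1)) ≡ Σℤ[ j to m / 2 ] (λ i → sign (i ∸ j) ℤ.* + (2 ^ (m ∸ 2 * i) * (i C j) * ((m ∸ i) C i)))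
odd-identity m j j≤N = begin
    + (suc m C (2 * j + 1))
  ≡⟨ cong +_ (sym (choose≡C (suc m) (2 * j + 1))) ⟩
    + odd m j
  ≡⟨ sym (binomial-inversion (suc m) (λ k → + odd m k) j (≤-<-trans j≤N N<B)) ⟩
    Σ< (suc m) (λ i → alt i j ℤ.* transform (suc m) (λ k → + odd m k) i)
  ≡⟨ Σ<-cong (suc m) (λ i _ → cong (alt i j ℤ.*_) (odd-transform m (suc m) (n<1+n m) i)) ⟩
    Σ< (suc m) (λ i → alt i j ℤ.* + cheb m i)
  ≡⟨ sym (Σℤ-as-Σ< (λ i → alt i j ℤ.* + cheb m i) j≤N N<B below above) ⟩
    Σℤ[ j to m / 2 ] (λ i → alt i j ℤ.* + cheb m i)
  ≡⟨ Σℤ-cong j (m / 2) term ⟩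
    Σℤ[ j to m / 2 ] (λ i → sign (i ∸ j) ℤ.* + (2 ^ (m ∸ 2 * i) * (i C j) * ((m ∸ i) C i))) ∎
  where
  open ≡-Reasoning
  N<B : m / 2 < suc m
  N<B = s≤s (m/n≤m m 2)
  below : ∀ i → i < j → alt i j ℤ.* + cheb m i ≡ + 0
  below i i<j = trans (cong (λ c → sign (i ∸ j) ℤ.* + c ℤ.* + cheb m i) (choose-vanish i<j))
                      (cong (λ s → s ℤ.* + cheb m i) (ℤP.*-zeroʳ (sign (i ∸ j))))
  above : ∀ i → m / 2 < i → alt i j ℤ.* + cheb m i ≡ + 0
  above i lt = trans (cong (λ c → alt i j ℤ.* + c) (cheb-vanish {m} {i} (half-bound m i lt))) (ℤP.*-zeroʳ (alt i j))
  reorder : ∀ a p b → a * (p * b) ≡ p * a * b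
  reorder = ℕ-Solver.solve-∀
  term : ∀ i → alt i j ℤ.* + cheb m i ≡ sign (i ∸ j) ℤ.* + (2 ^ (m ∸ 2 * i) * (i C j) * ((m ∸ i) C i))
  term i = begin
      sign (i ∸ j) ℤ.* + choose i j ℤ.* + cheb m i
    ≡⟨ ℤP.*-assoc (sign (i ∸ j)) (+ choose i j) (+ cheb m i) ⟩
      sign (i ∸ j) ℤ.* (+ choose i j ℤ.* + cheb m i)
    ≡⟨ cong (sign (i ∸ j) ℤ.*_) (sym (ℤP.pos-* (choose i j) (cheb m i))) ⟩
      sign (i ∸ j) ℤ.* + (choose i j * (2 ^ (m ∸ 2 * i) * choose (m ∸ i) i))
    ≡⟨ cong (λ c → sign (i ∸ j) ℤ.* + c)
            (trans (cong₂ (λ a b → a * (2 ^ (m ∸ 2 * i) * b)) (choose≡C i j) (choose≡C (m ∸ i) i))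
                   (reorder (i C j) (2 ^ (m ∸ 2 * i)) ((m ∸ i) C i))) ⟩
      sign (i ∸ j) ℤ.* + (2 ^ (m ∸ 2 * i) * (i C j) * ((m ∸ i) C i)) ∎

cheb-identity : ∀ m j → j ≤ m / 2 →
  2 ^ (m ∸ 2 * j) * ((m ∸ j) C j) ≡ Σℕ[ j to m / 2 ] (λ i → (suc m C (2 * i + 1)) * (i C j))
cheb-identity m j j≤N = ℤP.+-injective (begin
    + (2 ^ (m ∸ 2 * j) * ((m ∸ j) C j))
  ≡⟨ cong (λ c → + (2 ^ (m ∸ 2 * j) * c)) (sym (choose≡C (m ∸ j) j)) ⟩
    + cheb m j
  ≡⟨ sym (odd-transform m (suc m) (n<1+n m) j) ⟩
    transform (suc m) (λ k → + odd m k) j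
  ≡⟨ sym (Σℤ-as-Σ< (λ k → + choose k j ℤ.* + odd m k) j≤N (s≤s (m/n≤m m 2)) below above) ⟩
    Σℤ[ j to m / 2 ] (λ k → + choose k j ℤ.* + odd m k)
  ≡⟨ Σℤ-cong j (m / 2) term ⟩
    Σℤ[ j to m / 2 ] (λ i → + ((suc m C (2 * i + 1)) * (i C j)))
  ≡⟨ sym (Σℕ-cast j (m / 2) (λ i → (suc m C (2 * i + 1)) * (i C j))) ⟩
    + Σℕ[ j to m / 2 ] (λ i → (suc m C (2 * i + 1)) * (i C j)) ∎)
  where
  open ≡-Reasoning
  below : ∀ k → k < j → + choose k j ℤ.* + odd m k ≡ + 0
  below k k<j = cong (λ c → + c ℤ.* + odd m k) (choose-vanish k<j)
  above : ∀ k → m / 2 < k → + choose k j ℤ.* + odd m k ≡ + 0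
  above k lt = trans (cong (λ c → + choose k j ℤ.* + c) (odd-vanish {m} {k} (half-bound m k lt)))
                     (ℤP.*-zeroʳ (+ choose k j))
  term : ∀ k → + choose k j ℤ.* + odd m k ≡ + ((suc m C (2 * k + 1)) * (k C j))
  term k = trans (sym (ℤP.pos-* (choose k j) (odd m k)))
                 (cong +_ (trans (*-comm (choose k j) (odd m k))
                                 (cong₂ _*_ (choose≡C (suc m) (2 * k + 1)) (choose≡C k j))))

corollary1 : (n : ℕ) → 1 ≤ n → (j : ℕ) → 1 ≤ j → j ≤ (n ∸ 1) / 2 →
  (ℤ.+ (n C (2 * j + 1)) ≡ Σℤ[ j to (n ∸ 1) / 2 ] (λ i → sign (i ∸ j) ℤ.* ℤ.+ (2 ^ (n ∸ 1 ∸ 2 * i) * (i C j) * ((n ∸ 1 ∸ i) C i))))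
  × (2 ^ (n ∸ 1 ∸ 2 * j) * ((n ∸ 1 ∸ j) C j) ≡ Σℕ[ j to (n ∸ 1) / 2 ] (λ i → (n C (2 * i + 1)) * (i C j)))
corollary1 (suc m) _ j _ j≤m/2 = odd-identity m j j≤m/2 , cheb-identity m j j≤m/2
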